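{- Let $P$ be a finite bounded poset with an interpolating EL-labelling $\gamma$, let $\hat0=x_0\lessdot x_1\lessdot\cdots\lessdot x_n=\hat1$ be the increasing chain from $\hat0$ to $\hat1$, and let $l_i=\gamma(x_{i-1},x_i)$. Let $z\in P$ and $0\le i\le n$. If some unrefinable chain from $\hat0$ to $z$ has all its labels in $\{l_1,\dots,l_i\}$, then $z\le x_i$. Conversely, if $z\le x_i$, then all labels on any unrefinable chain from $\hat0$ to $z$ lie in $\{l_1,\dots,l_i\}$.
   Context: A poset is bounded if it has unique minimum $\hat0$ and maximum $\hat1$. An edge-labelling (map from covering relations to $\mathbb Z$) is an EL-labelling if for all $y<z$ there is a unique unrefinable chain from $y$ to $z$ with weakly increasing labels (the increasing chain), and its label sequence lexicographically precedes those of all other unrefinable chains from $y$ to $z$. It is interpolating if for every $y\lessdot u\lessdot z$, either $\gamma(y,u)<\gamma(u,z)$, or the increasing chain $y=w_0\lessdot\cdots\lessdot w_r=z$ has strictly increasing labels with $\gamma(w_0,w_1)=\gamma(u,z)$ and $\gamma(w_{r-1},w_r)=\gamma(y,u)$. -}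

module Defs where

open import Data.Nat using (ℕ)
open import Data.Fin using (Fin)
open import Data.Integer using (ℤ) renaming (_≤_ to _≤ℤ_; _<_ to _<ℤ_)
open import Data.List using (List; []; _∷_; head; last)
open import Data.List.Relation.Unary.Linked using (Linked)
open import Data.List.Relation.Binary.Lex.Strict using (Lex-<)
open import Data.Maybe using (just)
open import Data.Product using (Σ; _×_)
open import Data.Sum using (_⊎_)
open import Relation.Binary.Structures using (IsPartialOrder)
open import Relation.Binary.PropositionalEquality using (_≡_; _≢_)
open import Relation.Nullary using (¬_)

record FiniteBoundedPoset : Set₁ where
  field
    size           : ℕ
    _≤_            : Fin size → Fin size → Set
    isPartialOrder : IsPartialOrder _≡_ _≤_
    bot            : Fin size
    top            : Fin size
    bot-min        : ∀ x → bot ≤ x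
    top-max        : ∀ x → x ≤ top

  Carrier : Set
  Carrier = Fin size

  _<_ : Carrier → Carrier → Set
  x < y = (x ≤ y) × (x ≢ y)

  _⋖_ : Carrier → Carrier → Set
  x ⋖ y = (x < y) × (∀ w → x < w → w < y → ⊥')
    where open import Data.Empty renaming (⊥ to ⊥')

module _ (P : FiniteBoundedPoset) where
  open FiniteBoundedPoset P

  data Chain : Carrier → Carrier → Set where
    []  : ∀ {x} → Chain x x
    _∷_ : ∀ {x y z} → x ⋖ y → Chain y z → Chain x z

  vertices : ∀ {x z} → Chain x z → List Carrier
  vertices {x} []      = x ∷ []
  vertices {x} (_ ∷ c) = x ∷ vertices c

  -- An edge labelling: a map γ : Carrier → Carrier → ℤ, of which only the
  -- values on covering pairs are used.
  module _ (γ : Carrier → Carrier → ℤ) where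

    labels : ∀ {x z} → Chain x z → List ℤ
    labels []                 = []
    labels {x} (_∷_ {y = y} _ c) = γ x y ∷ labels c

    Increasing : ∀ {x z} → Chain x z → Set
    Increasing c = Linked _≤ℤ_ (labels c)

    StrictlyIncreasing : ∀ {x z} → Chain x z → Set
    StrictlyIncreasing c = Linked _<ℤ_ (labels c)

    -- lexicographic strict order on label sequences (a proper prefix is smaller)
    LexLess : List ℤ → List ℤ → Set
    LexLess = Lex-< _≡_ _<ℤ_

    IsEL : Set
    IsEL = ∀ y z → y < z →
      Σ (Chain y z) λ c →
        Increasing c
        × (∀ (c' : Chain y z) → Increasing c' → vertices c' ≡ vertices c)
        × (∀ (c' : Chain y z) → vertices c' ≢ vertices c → LexLess (labels c) (labels c'))

    IsInterpolating : Set
    IsInterpolating = ∀ y u z → y ⋖ u → u ⋖ z →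
      (γ y u <ℤ γ u z)
      ⊎ (∀ (c : Chain y z) → Increasing c →
           StrictlyIncreasing c
           × head (labels c) ≡ just (γ u z)
           × last (labels c) ≡ just (γ y u))

{-# OPTIONS --safe #-}
-- Interpolation makes every increasing chain strictly increasing, so l₁ < ⋯ < lₙ.  Everything
-- else comes from one rerouting step: if y ⋖ v ⋖ u with γ(v,u) < γ(y,v), interpolation replaces
-- y ⋖ v ⋖ u by the increasing chain from y to u, whose first label γ(v,u) is smaller than
-- γ(y,v) and whose labels climb up to γ(y,v).  Induction upwards in the finite poset and,
-- among the covers of a fixed y, on the label γ(y,v) then shows:
-- (1) the labels of every unrefinable chain from y to w occur on the increasing chain from y
--     to w; for a chain 0̂ → z → xᵢ this is the converse statement;
-- (2) from an element below xᵢ, a chain whose labels are all smaller than lᵢ₊₁, …, lₙ stays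
--     below xᵢ: for a cover y ⋖ v, either y ⋖ v followed by the increasing chain from v to 1̂
--     is increasing, hence is the increasing chain through xᵢ, which puts v below xᵢ, or
--     rerouting replaces v by a cover of y with a smaller label.
module Submission where

open import Defs
open import Data.Integer using (ℤ)
import Data.Integer as ℤ
import Data.Integer.Properties as ℤ
open import Data.Fin using (Fin; toℕ; zero; suc; _≟_)
open import Data.Fin.Induction using (spo-wellFounded; po-noetherian)
open import Data.List using (List; []; _∷_; _++_; length; lookup; take; last)
open import Data.List.Membership.Propositional using (_∈_)
open import Data.List.Relation.Unary.All using (All)
open import Data.List.Properties using (∷-injectiveˡ; ∷-injectiveʳ)
open import Data.List.Membership.Propositional.Properties using (∈-++⁺ˡ)
open import Data.List.Relation.Binary.Subset.Propositional using (_⊆_)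
open import Data.List.Relation.Binary.Subset.Propositional.Properties
  using (⊆-trans; ⊆-reflexive; ∷⁺ʳ; ∈-∷⁺ʳ; xs⊆xs++ys; xs⊆ys++xs; All-resp-⊇)
open import Data.List.Relation.Unary.Any using (here; there)
import Data.List.Relation.Unary.All as All
import Data.List.Relation.Unary.All.Properties as All
open import Data.List.Relation.Unary.AllPairs using (AllPairs; _∷_)
open import Data.List.Relation.Unary.Linked as Linked using (Linked; []; [-]; _∷_)
open import Data.List.Relation.Unary.Linked.Properties using (Linked⇒AllPairs)
open import Data.Maybe using (just)
open import Data.Maybe.Properties using (just-injective)
open import Data.Product using (Σ; ∃; _×_; _,_; proj₁; proj₂)
open import Data.Sum using (inj₁; inj₂)
open import Data.Empty using (⊥-elim)
open import Function using (flip; _on_)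
open import Induction.WellFounded using (WellFounded; Acc; acc)
open import Relation.Nullary using (¬_; yes; no)
open import Relation.Binary.Core using (Rel)
open import Relation.Binary.Definitions using (Reflexive; Transitive)
open import Relation.Binary.Structures using (IsPartialOrder)
import Relation.Binary.Construct.On as On
open import Relation.Binary.PropositionalEquality using (_≡_; refl; sym; cong; subst)

open FiniteBoundedPoset using (Carrier)

module _ {a r} {A : Set a} {R : Rel A r} where

  Linked-++⁻ : ∀ xs {ys} → Linked R (xs ++ ys) → Linked R xs × Linked R ys
  Linked-++⁻ []           l       = [] , l
  Linked-++⁻ (x ∷ [])     l       = [-] , Linked.tail l
  Linked-++⁻ (x ∷ y ∷ xs) (r ∷ l) = let lxs , lys = Linked-++⁻ (y ∷ xs) l in r ∷ lxs , lys

  Linked-++⁺ : ∀ {xs ys} → Linked R xs → Linked R ys → All (λ x → All (R x) ys) xs →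
               Linked R (xs ++ ys)
  Linked-++⁺              []      lys _                     = lys
  Linked-++⁺ {ys = []}    [-]     _   _                     = [-]
  Linked-++⁺ {ys = _ ∷ _} [-]     lys ((r All.∷ _) All.∷ _) = r ∷ lys
  Linked-++⁺              (r ∷ l) lys (_ All.∷ rs)          = r ∷ Linked-++⁺ l lys rs

  AllPairs-++⁻ : ∀ xs {ys} → AllPairs R (xs ++ ys) → All (λ x → All (R x) ys) xs
  AllPairs-++⁻ []       _          = All.[]
  AllPairs-++⁻ (x ∷ xs) (rs ∷ rss) = All.++⁻ʳ xs rs All.∷ AllPairs-++⁻ xs rss

  Linked⇒All-last : Reflexive R → Transitive R →
                    ∀ {xs m} → Linked R xs → last xs ≡ just m → All (λ x → R x m) xs
  Linked⇒All-last R-refl R-trans [-]     refl = R-refl All.∷ All.[]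
  Linked⇒All-last R-refl R-trans (r ∷ l) eq with Linked⇒All-last R-refl R-trans l eq
  ... | below-last = R-trans r (All.head below-last) All.∷ below-last

Linked-<⇒All-≤-last : ∀ {xs m} → Linked ℤ._<_ xs → last xs ≡ just m → All (ℤ._≤ m) xs
Linked-<⇒All-≤-last l = Linked⇒All-last ℤ.≤-refl ℤ.≤-trans (Linked.map ℤ.<⇒≤ l)

last-∈ : ∀ {a} {A : Set a} {xs : List A} {m} → last xs ≡ just m → m ∈ xs
last-∈ {xs = x ∷ []}     refl = here refl
last-∈ {xs = x ∷ y ∷ xs} eq   = there (last-∈ {xs = y ∷ xs} eq)

infixr 5 _++ᶜ_
_++ᶜ_ : ∀ {P x y z} → Chain P x y → Chain P y z → Chain P x z
[]      ++ᶜ e = e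
(p ∷ d) ++ᶜ e = p ∷ (d ++ᶜ e)

module Chains (P : FiniteBoundedPoset) where
  open FiniteBoundedPoset P hiding (Carrier)
  module ≤ = IsPartialOrder isPartialOrder

  <-irrefl : ∀ {x} → ¬ x < x
  <-irrefl (_ , x≢x) = x≢x refl

  <-≤-trans : ∀ {x y z} → x < y → y ≤ z → x < z
  <-≤-trans (x≤y , x≢y) y≤z =
    ≤.trans x≤y y≤z , λ { refl → x≢y (≤.antisym x≤y y≤z) }

  ⋖⇒< : ∀ {x y} → x ⋖ y → x < y
  ⋖⇒< = proj₁

  ⋖⇒≤ : ∀ {x y} → x ⋖ y → x ≤ y
  ⋖⇒≤ x⋖y = proj₁ (⋖⇒< x⋖y)

  chain⇒≤ : ∀ {x z} → Chain P x z → x ≤ z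
  chain⇒≤ []      = ≤.refl
  chain⇒≤ (p ∷ d) = ≤.trans (⋖⇒≤ p) (chain⇒≤ d)

  ⋖-chain⇒< : ∀ {x y z} → x ⋖ y → Chain P y z → x < z
  ⋖-chain⇒< p d = <-≤-trans (⋖⇒< p) (chain⇒≤ d)

  >-wellFounded : WellFounded (flip _<_)
  >-wellFounded = po-noetherian isPartialOrder

  vertices-≡⇒source-≡ : ∀ {v v' z z'} (d : Chain P v z) (e : Chain P v' z') →
                        vertices P d ≡ vertices P e → v ≡ v'
  vertices-≡⇒source-≡ []      []      = ∷-injectiveˡ
  vertices-≡⇒source-≡ []      (_ ∷ _) = ∷-injectiveˡ
  vertices-≡⇒source-≡ (_ ∷ _) []      = ∷-injectiveˡ
  vertices-≡⇒source-≡ (_ ∷ _) (_ ∷ _) = ∷-injectiveˡ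

module Labels (P : FiniteBoundedPoset) (γ : Carrier P → Carrier P → ℤ) where
  open FiniteBoundedPoset P hiding (Carrier)
  open Chains P

  labels-++ᶜ : ∀ {x y z} (d : Chain P x y) (e : Chain P y z) →
               labels P γ (d ++ᶜ e) ≡ labels P γ d ++ labels P γ e
  labels-++ᶜ []      e = refl
  labels-++ᶜ (p ∷ d) e = cong (γ _ _ ∷_) (labels-++ᶜ d e)

  labels-⊆-++ᶜˡ : ∀ {x y z} (d : Chain P x y) (e : Chain P y z) →
                  labels P γ d ⊆ labels P γ (d ++ᶜ e)
  labels-⊆-++ᶜˡ d e = ⊆-trans (xs⊆xs++ys _ _) (⊆-reflexive (sym (labels-++ᶜ d e)))

  labels-⊆-++ᶜʳ : ∀ {x y z} (d : Chain P x y) (e : Chain P y z) →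
                  labels P γ e ⊆ labels P γ (d ++ᶜ e)
  labels-⊆-++ᶜʳ d e = ⊆-trans (xs⊆ys++xs _ _) (⊆-reflexive (sym (labels-++ᶜ d e)))

  vertices-≡⇒labels-≡ : ∀ {x z} (d e : Chain P x z) →
                        vertices P d ≡ vertices P e → labels P γ d ≡ labels P γ e
  vertices-≡⇒labels-≡ []      []      _  = refl
  vertices-≡⇒labels-≡ []      (q ∷ e) _  = ⊥-elim (<-irrefl (⋖-chain⇒< q e))
  vertices-≡⇒labels-≡ (p ∷ d) []      _  = ⊥-elim (<-irrefl (⋖-chain⇒< p d))
  vertices-≡⇒labels-≡ (p ∷ d) (q ∷ e) eq
    with refl ← vertices-≡⇒source-≡ d e (∷-injectiveʳ eq)
    = cong (γ _ _ ∷_) (vertices-≡⇒labels-≡ d e (∷-injectiveʳ eq))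

  splitAt : ∀ {x z} (c : Chain P x z) (i : Fin (length (vertices P c))) →
            Σ (Chain P x (lookup (vertices P c) i)) λ pre →
            Σ (Chain P (lookup (vertices P c) i) z) λ suf →
            (pre ++ᶜ suf ≡ c) × (labels P γ pre ≡ take (toℕ i) (labels P γ c))
  splitAt []      zero    = [] , [] , refl , refl
  splitAt (p ∷ c) zero    = [] , p ∷ c , refl , refl
  splitAt (p ∷ c) (suc i) =
    let pre , suf , pre++suf≡c , labels-pre = splitAt c i
    in p ∷ pre , suf , cong (p ∷_) pre++suf≡c , cong (γ _ _ ∷_) labels-pre

  label-<-wellFounded : ∀ y → WellFounded (ℤ._<_ on γ y)
  label-<-wellFounded y =
    spo-wellFounded (On.isStrictPartialOrder (γ y) ℤ.<-isStrictPartialOrder)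

  data Prepend {y v w} (p : y ⋖ v) : Chain P v w → Set where
    ascends  : ∀ {h} → Increasing P γ (p ∷ h) → Prepend p h
    descends : ∀ {u} (q : v ⋖ u) (h : Chain P u w) → γ v u ℤ.< γ y v → Prepend p (q ∷ h)

  prepend : ∀ {y v w} (p : y ⋖ v) {h : Chain P v w} → Increasing P γ h → Prepend p h
  prepend p {[]} _ = ascends [-]
  prepend {y} {v} p {q ∷ h} inc-h with γ y v ℤ.≤? γ v _
  ... | yes asc  = ascends (asc ∷ inc-h)
  ... | no  ¬asc = descends q h (ℤ.≰⇒> ¬asc)

module ELChains (P : FiniteBoundedPoset) (γ : Carrier P → Carrier P → ℤ) (el : IsEL P γ) where
  open FiniteBoundedPoset P hiding (Carrier)
  open Chains P
  open Labels P γ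

  increasingChain : ∀ {y w} → y ≤ w → Σ (Chain P y w) (Increasing P γ)
  increasingChain {y} {w} y≤w with y ≟ w
  ... | yes refl = [] , []
  ... | no  y≢w  = let c , inc-c , _ = el y w (y≤w , y≢w) in c , inc-c

  increasing-unique : ∀ {y w} (e e' : Chain P y w) → Increasing P γ e → Increasing P γ e' →
                      vertices P e ≡ vertices P e'
  increasing-unique []      []       _     _      = refl
  increasing-unique []      (q ∷ e') _     _      = ⊥-elim (<-irrefl (⋖-chain⇒< q e'))
  increasing-unique (p ∷ e) e'       inc-e inc-e' =
    let _ , _ , unique , _ = el _ _ (⋖-chain⇒< p e)
    in subst (_ ≡_) (sym (unique e' inc-e')) (unique (p ∷ e) inc-e)

  increasing-labels-unique : ∀ {y w} (e e' : Chain P y w) →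
                             Increasing P γ e → Increasing P γ e' → labels P γ e ≡ labels P γ e'
  increasing-labels-unique e e' inc-e inc-e' =
    vertices-≡⇒labels-≡ e e' (increasing-unique e e' inc-e inc-e')

module InterpolatingChains (P : FiniteBoundedPoset) (γ : Carrier P → Carrier P → ℤ)
                           (el : IsEL P γ) (ip : IsInterpolating P γ) where
  open FiniteBoundedPoset P hiding (Carrier)
  open Chains P
  open Labels P γ
  open ELChains P γ el

  record Interpolation (y a b : Carrier P) : Set where
    constructor interpolation
    field
      {via}       : Carrier P
      first       : y ⋖ via
      rest        : Chain P via b
      first-label : γ y via ≡ γ a b
      strictly    : StrictlyIncreasing P γ (first ∷ rest)
      last-label  : last (labels P γ (first ∷ rest)) ≡ just (γ y a)

  interpolate : ∀ {y a b} → y ⋖ a → a ⋖ b → γ a b ℤ.≤ γ y a → Interpolation y a b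
  interpolate p q desc with ip _ _ _ p q
  ... | inj₁ asc = ⊥-elim (ℤ.≤⇒≯ desc asc)
  ... | inj₂ forced with increasingChain (≤.trans (⋖⇒≤ p) (⋖⇒≤ q))
  ... | []    , _     = ⊥-elim (<-irrefl (⋖-chain⇒< p (q ∷ [])))
  ... | r ∷ e , inc-e =
    let strictly , first-label , last-label = forced (r ∷ e) inc-e
    in interpolation r e (just-injective first-label) strictly last-label

  ascent-strict : ∀ {y a b} (p : y ⋖ a) (q : a ⋖ b) → γ y a ℤ.≤ γ a b → γ y a ℤ.< γ a b
  ascent-strict {y} {a} {b} p q asc with γ y a ℤ.<? γ a b
  ... | yes lt = lt
  ... | no  ¬lt with interpolate p q (ℤ.≮⇒≥ ¬lt)
  ... | interpolation r [] _ _ _ = ⊥-elim (proj₂ r a (⋖⇒< p) (⋖⇒< q))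
  ... | interpolation {t} r (_∷_ {y = s} _ e) first-label (lt ∷ strictly) last-label =
    ⊥-elim (ℤ.≤⇒≯ asc (begin-strict
      γ a b  ≡⟨ first-label ⟨
      γ y t  <⟨ lt ⟩
      γ t s  ≤⟨ All.head (Linked-<⇒All-≤-last strictly last-label) ⟩
      γ y a  ∎))
    where open ℤ.≤-Reasoning

  increasing⇒strictly : ∀ {y w} (e : Chain P y w) → Increasing P γ e → StrictlyIncreasing P γ e
  increasing⇒strictly []          _             = []
  increasing⇒strictly (p ∷ [])    _             = [-]
  increasing⇒strictly (p ∷ q ∷ e) (asc ∷ inc-e) =
    ascent-strict p q asc ∷ increasing⇒strictly (q ∷ e) inc-e

  labels-⊆-increasing : ∀ {y w} (d e : Chain P y w) → Increasing P γ e →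
                        labels P γ d ⊆ labels P γ e
  labels-⊆-increasing {y} = from (>-wellFounded y)
    where
    from : ∀ {y w} → Acc (flip _<_) y → (d e : Chain P y w) → Increasing P γ e →
           labels P γ d ⊆ labels P γ e
    from _ [] _ _ = λ ()
    from {y} {w} (acc above) (p₀ ∷ d₀) e inc-e = go (label-<-wellFounded y _) p₀ d₀
      where
      go : ∀ {v} → Acc (ℤ._<_ on γ y) v → (p : y ⋖ v) (d : Chain P v w) →
           labels P γ (p ∷ d) ⊆ labels P γ e
      go {v} (acc smaller) p d with increasingChain (chain⇒≤ d)
      ... | f , inc-f with prepend p inc-f
      ... | ascends inc-pf =
        ⊆-trans (∷⁺ʳ _ (from (above (⋖⇒< p)) d f inc-f))
                (⊆-reflexive (increasing-labels-unique (p ∷ f) e inc-pf inc-e))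
      ... | descends {u} q f′ desc with interpolate p q (ℤ.<⇒≤ desc)
      ... | interpolation r T first-label _ last-label =
        ⊆-trans (∷⁺ʳ _ (from (above (⋖⇒< p)) d (q ∷ f′) inc-f))
          (⊆-trans detour (go (smaller (subst (ℤ._< γ y v) (sym first-label) desc)) r (T ++ᶜ f′)))
        where
        covered : γ y v ∷ γ v u ∷ labels P γ f′ ⊆ labels P γ (r ∷ T) ++ labels P γ f′
        covered = ∈-∷⁺ʳ (∈-++⁺ˡ (last-∈ {xs = labels P γ (r ∷ T)} last-label))
                    (∈-∷⁺ʳ (∈-++⁺ˡ (here {xs = labels P γ T} (sym first-label))) (xs⊆ys++xs _ _))

        detour : γ y v ∷ γ v u ∷ labels P γ f′ ⊆ labels P γ (r ∷ (T ++ᶜ f′))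
        detour = ⊆-trans covered (⊆-reflexive (sym (labels-++ᶜ (r ∷ T) f′)))

module Pivot (P : FiniteBoundedPoset) (γ : Carrier P → Carrier P → ℤ)
             (el : IsEL P γ) (ip : IsInterpolating P γ)
             {X : Carrier P} (pre : Chain P (FiniteBoundedPoset.bot P) X)
             (suf : Chain P X (FiniteBoundedPoset.top P)) (inc : Increasing P γ (pre ++ᶜ suf)) where
  open FiniteBoundedPoset P hiding (Carrier)
  open Chains P
  open Labels P γ
  open ELChains P γ el
  open InterpolatingChains P γ el ip

  Below : ℤ → Set
  Below ℓ = All (ℓ ℤ.<_) (labels P γ suf)

  Confined : Carrier P → Set
  Confined y = y ≤ X → ∀ {w} (d : Chain P y w) → All Below (labels P γ d) → w ≤ X

  segments-increasing : Increasing P γ pre × Increasing P γ suf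
  segments-increasing =
    Linked-++⁻ (labels P γ pre) (subst (Linked ℤ._≤_) (labels-++ᶜ pre suf) inc)

  pre-below : All Below (labels P γ pre)
  pre-below = AllPairs-++⁻ (labels P γ pre) (Linked⇒AllPairs ℤ.<-trans
    (subst (Linked ℤ._<_) (labels-++ᶜ pre suf) (increasing⇒strictly (pre ++ᶜ suf) inc)))

  labels-⊆-pre : (d : Chain P bot X) → labels P γ d ⊆ labels P γ pre
  labels-⊆-pre d = labels-⊆-increasing d pre (proj₁ segments-increasing)

  through-X-increasing : ∀ {y} (e : Chain P y X) → Increasing P γ e → Increasing P γ (e ++ᶜ suf)
  through-X-increasing {y} e inc-e = subst (Linked ℤ._≤_) (sym (labels-++ᶜ e suf))
    (Linked-++⁺ inc-e (proj₂ segments-increasing)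
      (All.map (All.map ℤ.<⇒≤) (All-resp-⊇ e⊆pre pre-below)))
    where
    e⊆pre : labels P γ e ⊆ labels P γ pre
    e⊆pre = ⊆-trans (labels-⊆-++ᶜʳ g e) (labels-⊆-pre (g ++ᶜ e))
      where
      g : Chain P bot y
      g = proj₁ (increasingChain (bot-min y))

  -- p ∷ h is the increasing chain from y through X; its first label rules out y = X.
  ascending-cover-≤ : ∀ {y v} → y ≤ X → (p : y ⋖ v) (h : Chain P v top) →
                      Increasing P γ (p ∷ h) → Below (γ y v) → v ≤ X
  ascending-cover-≤ {y} {v} y≤X p h inc-ph below with increasingChain y≤X
  ... | [] , inc-e =
    ⊥-elim (ℤ.<-irrefl refl (All.head (subst (All (γ y v ℤ.<_)) (sym same-labels) below)))
    where
    same-labels : labels P γ (p ∷ h) ≡ labels P γ suf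
    same-labels = increasing-labels-unique (p ∷ h) suf inc-ph (through-X-increasing [] inc-e)
  ... | r ∷ e , inc-e =
    subst (_≤ X) (sym (vertices-≡⇒source-≡ h (e ++ᶜ suf) (∷-injectiveʳ same-vertices))) (chain⇒≤ e)
    where
    same-vertices : vertices P (p ∷ h) ≡ vertices P (r ∷ e ++ᶜ suf)
    same-vertices =
      increasing-unique (p ∷ h) (r ∷ e ++ᶜ suf) inc-ph (through-X-increasing (r ∷ e) inc-e)

  cover-≤ : ∀ {y} → (∀ {t} → y < t → Confined t) → y ≤ X →
            ∀ {v} → Acc (ℤ._<_ on γ y) v → (p : y ⋖ v) → Below (γ y v) → v ≤ X
  cover-≤ {y} confined-above y≤X {v} (acc smaller) p below with increasingChain (top-max v)
  ... | h , inc-h with prepend p inc-h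
  ... | ascends inc-ph = ascending-cover-≤ y≤X p h inc-ph below
  ... | descends q _ desc with interpolate p q (ℤ.<⇒≤ desc)
  ... | interpolation {t} r T first-label strictly last-label =
    ≤.trans (⋖⇒≤ q) (confined-above (⋖⇒< r) t≤X T T-below)
    where
    first<γyv : γ y t ℤ.< γ y v
    first<γyv = subst (ℤ._< γ y v) (sym first-label) desc

    t≤X : t ≤ X
    t≤X = cover-≤ confined-above y≤X (smaller first<γyv) r (All.map (ℤ.<-trans first<γyv) below)

    T-below : All Below (labels P γ T)
    T-below = All.map (λ ℓ≤γyv → All.map (ℤ.≤-<-trans ℓ≤γyv) below)
      (All.tail (Linked-<⇒All-≤-last strictly last-label))

  confined : ∀ {y} → Acc (flip _<_) y → Confined y
  confined _ y≤X [] _ = y≤X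
  confined {y} (acc above) y≤X (_∷_ {y = v} p d) (b All.∷ bs) =
    confined (above (⋖⇒< p)) v≤X d bs
    where
    v≤X : v ≤ X
    v≤X = cover-≤ (λ y<t → confined (above y<t)) y≤X (label-<-wellFounded y _) p b

  ⊆-pre⇒≤X : ∀ {z} (d : Chain P bot z) → labels P γ d ⊆ labels P γ pre → z ≤ X
  ⊆-pre⇒≤X d d⊆pre = confined (>-wellFounded bot) (bot-min X) d (All-resp-⊇ d⊆pre pre-below)

  ≤X⇒⊆-pre : ∀ {z} → z ≤ X → (d : Chain P bot z) → labels P γ d ⊆ labels P γ pre
  ≤X⇒⊆-pre {z} z≤X d = ⊆-trans (labels-⊆-++ᶜˡ d g) (labels-⊆-pre (d ++ᶜ g))
    where
    g : Chain P z X
    g = proj₁ (increasingChain z≤X)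

lemma8 : (P : FiniteBoundedPoset) → (γ : FiniteBoundedPoset.Carrier P → FiniteBoundedPoset.Carrier P → ℤ) →
         IsEL P γ → IsInterpolating P γ →
         (c : Chain P (FiniteBoundedPoset.bot P) (FiniteBoundedPoset.top P)) → Increasing P γ c →
         (z : FiniteBoundedPoset.Carrier P) → (i : Fin (length (vertices P c))) →
         ((∃ λ (d : Chain P (FiniteBoundedPoset.bot P) z) → All (_∈ take (toℕ i) (labels P γ c)) (labels P γ d))
            → FiniteBoundedPoset._≤_ P z (lookup (vertices P c) i))
         × (FiniteBoundedPoset._≤_ P z (lookup (vertices P c) i)
            → ∀ (d : Chain P (FiniteBoundedPoset.bot P) z) → All (_∈ take (toℕ i) (labels P γ c)) (labels P γ d))
lemma8 P γ el ip c inc-c z i with Labels.splitAt P γ c i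
... | pre , suf , pre++suf≡c , labels-pre =
  (λ (d , d⊆) → ⊆-pre⇒≤X d (λ ℓ∈d → subst (_ ∈_) (sym labels-pre) (All.lookup d⊆ ℓ∈d))) ,
  (λ z≤x d → All.tabulate (λ ℓ∈d → subst (_ ∈_) labels-pre (≤X⇒⊆-pre z≤x d ℓ∈d)))
  where open Pivot P γ el ip pre suf (subst (Increasing P γ) (sym pre++suf≡c) inc-c)
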